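{- Let $n\ge1$ and let $L$ be a list assignment for $K_{n,n^n}$ such that $|L(v)|\ge n$ for every vertex $v$. If $\mathrm{col}(K_{n,n^n},L)=0$, then $L$ is equivalent to $L_0$.
   Context: A list assignment for a graph assigns to each vertex $v$ a finite set $L(v)\subseteq\mathbb{N}$; a coloring from $L$ is a map $\gamma$ with $\gamma(v)\in L(v)$ and $\gamma(v)\ne\gamma(w)$ for adjacent $v,w$; $\mathrm{col}(G,L)$ is the number of such colorings. Denote the vertices of the complete bipartite graph $K_{n,n^n}$ by $a_1,\dots,a_n$ (one side) and $b_1,\dots,b_{n^n}$ (other side). $L_0$ denotes an $n$-list assignment for $K_{n,n^n}$ (every list of size $n$) such that $L_0(a_i)\cap L_0(a_j)=\emptyset$ for all $i\ne j$, $L_0(b_k)\ne L_0(b_l)$ for all $k\ne l$, and each $L_0(a_i)$ shares exactly one element with each $L_0(b_k)$ (so each $L_0(b_k)$ consists of exactly one color from each $L_0(a_i)$). Two list assignments $L,L'$ for a graph $G$ are equivalent if there is a bijection $f:\mathbb{N}\to\mathbb{N}$ and an automorphism $\phi$ of $G$ such that $L'(v)=f(L(\phi(v)))$ for every vertex $v$. -}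

module Defs where

open import Level using (0ℓ)
open import Data.Nat using (ℕ; _^_; _≥_)
open import Data.Fin using (Fin)
open import Data.Sum using (_⊎_; inj₁; inj₂)
open import Data.Product using (Σ; ∃; ∃-syntax; _×_; _,_)
open import Data.Empty using (⊥)
open import Data.Unit using (⊤)
open import Data.List using (List)
open import Data.List.Membership.Propositional using (_∈_)
open import Relation.Nullary using (¬_)
open import Relation.Binary.PropositionalEquality using (_≡_)
open import Function.Bundles using (_⇔_; _⤖_; Bijection)
open import Function.Definitions using (Injective)

-- A finite set of colours (subset of ℕ) is represented by a list; only
-- membership matters (duplicates / order are irrelevant).
FinSet : Set
FinSet = List ℕ

_≐_ : FinSet → FinSet → Set
A ≐ B = ∀ c → (c ∈ A) ⇔ (c ∈ B)

AtLeast : ℕ → FinSet → Set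
AtLeast k A = Σ (Fin k → ℕ) λ e → Injective _≡_ _≡_ e × (∀ i → e i ∈ A)

Size : ℕ → FinSet → Set
Size k A = Σ (Fin k → ℕ) λ e → Injective _≡_ _≡_ e × (∀ c → (c ∈ A) ⇔ (∃[ i ] e i ≡ c))

record Graph : Set₁ where
  field
    V   : Set
    Adj : V → V → Set
open Graph public

-- complete bipartite graph K_{n,m}: vertices a_i = inj₁ i, b_k = inj₂ k
K : ℕ → ℕ → Graph
K n m = record { V = Fin n ⊎ Fin m ; Adj = adj }
  where
  adj : Fin n ⊎ Fin m → Fin n ⊎ Fin m → Set
  adj (inj₁ _) (inj₁ _) = ⊥
  adj (inj₁ _) (inj₂ _) = ⊤
  adj (inj₂ _) (inj₁ _) = ⊤
  adj (inj₂ _) (inj₂ _) = ⊥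

ListAssignment : Graph → Set
ListAssignment G = V G → FinSet

Coloring : (G : Graph) → ListAssignment G → Set
Coloring G L = Σ (V G → ℕ) λ γ →
  (∀ v → γ v ∈ L v) × (∀ v w → Adj G v w → ¬ (γ v ≡ γ w))

-- col(G,L) = 0  ⟺  there is no colouring from L
ColZero : (G : Graph) → ListAssignment G → Set
ColZero G L = ¬ Coloring G L

Automorphism : Graph → Set
Automorphism G = Σ (V G ⤖ V G) λ φ →
  ∀ v w → Adj G v w ⇔ Adj G (Bijection.to φ v) (Bijection.to φ w)

_∈Img[_]_ : ℕ → (ℕ → ℕ) → FinSet → Set
c ∈Img[ f ] A = ∃[ d ] (d ∈ A × f d ≡ c)

Equivalent : (G : Graph) → ListAssignment G → ListAssignment G → Set
Equivalent G L L' = Σ (ℕ ⤖ ℕ) λ f → Σ (Automorphism G) λ where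
  (φ , _) → ∀ v c → (c ∈ L' v) ⇔ (c ∈Img[ Bijection.to f ] L (Bijection.to φ v))

-- the defining properties of L₀ on K_{n,n^n}
IsL₀ : (n : ℕ) → ListAssignment (K n (n ^ n)) → Set
IsL₀ n L =
    (∀ v → Size n (L v))
  × (∀ i j → ¬ (i ≡ j) → ∀ c → c ∈ L (inj₁ i) → ¬ (c ∈ L (inj₁ j)))
  × (∀ k l → ¬ (k ≡ l) → ¬ (L (inj₂ k) ≐ L (inj₂ l)))
  × (∀ i k → ∃[ c ] ((c ∈ L (inj₁ i) × c ∈ L (inj₂ k))
                     × (∀ d → d ∈ L (inj₁ i) → d ∈ L (inj₂ k) → d ≡ c)))

-- Choose n colours S(aᵢ) ⊆ L(aᵢ) for each i.  Since no colouring exists, every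
-- transversal of the lists of the aᵢ is blocked by some bₖ, i.e. L(bₖ) lies in its
-- image; as |L(bₖ)| ≥ n, the transversal is injective and L(bₖ) is exactly its image.
-- Applied to a transversal using one colour c twice this shows that the L(aᵢ) are
-- disjoint, and then distinct transversals of S are blocked by distinct bₖ.  There are
-- n^n of them and n^n vertices bₖ, so every L(bₖ) is a transversal of S.  A colour of
-- L(aᵢ) outside S(aᵢ) lies on a transversal, hence in some L(bₖ), which is impossible.
-- Hence L itself has the defining properties of L₀.
module Submission where

open import Defs
open import Data.Nat as ℕ using (ℕ; _^_; _≥_)
open import Data.Nat.Properties using (n≮n)
open import Data.Fin using (Fin; zero; suc; punchOut; finToFun; funToFin; combine)
open import Data.Fin.Properties using (any?; punchOut-injective; injective⇒≤; funToFin-finToFin)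
  renaming (_≟_ to _≟ᶠ_)
open import Data.Vec.Functional using (updateAt)
open import Data.Vec.Functional.Properties using (updateAt-updates; updateAt-minimal)
open import Data.Product using (Σ; _×_; _,_; proj₁; proj₂; ∃-syntax)
open import Data.Sum using (inj₁; inj₂)
open import Data.List.Membership.Propositional using (_∈_; find)
open import Data.List.Relation.Unary.All using (all?; lookup)
open import Data.List.Relation.Unary.All.Properties using (¬All⇒Any¬)
open import Data.Empty using (⊥-elim)
open import Relation.Nullary using (¬_; Dec; yes; no)
open import Relation.Binary.PropositionalEquality
  using (_≡_; _≢_; _≗_; refl; sym; trans; cong; cong₂; subst; module ≡-Reasoning)
open import Function using (_∘_; id)
open import Function.Bundles using (_⇔_; mk⇔; Equivalence)
open import Function.Definitions using (Injective)
open import Function.Construct.Identity using (⤖-id; ⇔-id)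

injective⇒surjective : ∀ {m} {f : Fin m → Fin m} → Injective _≡_ _≡_ f → ∀ y → ∃[ x ] f x ≡ y
injective⇒surjective {ℕ.zero} _ ()
injective⇒surjective {ℕ.suc m} {f} f-inj y with any? (λ x → f x ≟ᶠ y)
... | yes hit = hit
... | no miss = ⊥-elim (n≮n m (injective⇒≤ {f = g} g-inj))
  where
  y≢f : ∀ x → y ≢ f x
  y≢f x y≡fx = miss (x , sym y≡fx)
  g : Fin (ℕ.suc m) → Fin m
  g x = punchOut (y≢f x)
  g-inj : Injective _≡_ _≡_ g
  g-inj {x} {x′} eq = f-inj (punchOut-injective (y≢f x) (y≢f x′) eq)

funToFin-cong : ∀ {m n} {f g : Fin m → Fin n} → f ≗ g → funToFin f ≡ funToFin g
funToFin-cong {ℕ.zero}  _   = refl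
funToFin-cong {ℕ.suc m} f≗g = cong₂ combine (f≗g zero) (funToFin-cong (f≗g ∘ suc))

finToFun-injective : ∀ {m n} {x y : Fin (m ^ n)} → finToFun {m} {n} x ≗ finToFun y → x ≡ y
finToFun-injective {m} {n} {x} {y} eq = begin
  x                             ≡⟨ sym (funToFin-finToFin {n} {m} x) ⟩
  funToFin (finToFun {m} {n} x) ≡⟨ funToFin-cong eq ⟩
  funToFin (finToFun {m} {n} y) ≡⟨ funToFin-finToFin {n} {m} y ⟩
  y                             ∎
  where open ≡-Reasoning

equivalent-refl : (G : Graph) (L : ListAssignment G) → Equivalent G L L
equivalent-refl G L = ⤖-id ℕ , (⤖-id (V G) , λ _ _ → ⇔-id _) , λ _ c →
  mk⇔ (λ c∈L → c , c∈L , refl) (λ { (_ , d∈L , refl) → d∈L })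

_∈Im_ : ∀ {n} → ℕ → (Fin n → ℕ) → Set
c ∈Im γ = ∃[ j ] γ j ≡ c

_⊆Im_ : ∀ {n} → FinSet → (Fin n → ℕ) → Set
A ⊆Im γ = ∀ {c} → c ∈ A → c ∈Im γ

_Enumerates_ : ∀ {n} → (Fin n → ℕ) → FinSet → Set
γ Enumerates A = Injective _≡_ _≡_ γ × (∀ c → c ∈ A ⇔ c ∈Im γ)

_∈Im?_ : ∀ {n} (c : ℕ) (γ : Fin n → ℕ) → Dec (c ∈Im γ)
c ∈Im? γ = any? (λ j → γ j ℕ.≟ c)

Enumerates⇒∈ : ∀ {n A} {γ : Fin n → ℕ} → γ Enumerates A → ∀ i → γ i ∈ A
Enumerates⇒∈ (_ , γ≐A) i = Equivalence.from (γ≐A _) (i , refl)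

Enumerates⇒⊆Im : ∀ {n A} {γ : Fin n → ℕ} → γ Enumerates A → A ⊆Im γ
Enumerates⇒⊆Im (_ , γ≐A) = Equivalence.to (γ≐A _)

⊆Im∧AtLeast⇒Enumerates : ∀ {n A} {γ : Fin n → ℕ} → AtLeast n A → A ⊆Im γ → γ Enumerates A
⊆Im∧AtLeast⇒Enumerates {n} {A} {γ} (e , e-inj , e∈A) A⊆γ = γ-inj , λ c → mk⇔ A⊆γ γ-onto
  where
  pre : Fin n → Fin n
  pre x = proj₁ (A⊆γ (e∈A x))
  γ∘pre : ∀ x → γ (pre x) ≡ e x
  γ∘pre x = proj₂ (A⊆γ (e∈A x))
  pre-inj : Injective _≡_ _≡_ pre
  pre-inj {x} {x′} eq = e-inj (trans (sym (γ∘pre x)) (trans (cong γ eq) (γ∘pre x′)))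
  γ-inj : Injective _≡_ _≡_ γ
  γ-inj {y} {y′} eq with injective⇒surjective pre-inj y | injective⇒surjective pre-inj y′
  ... | x , refl | x′ , refl = cong pre (e-inj (trans (sym (γ∘pre x)) (trans eq (γ∘pre x′))))
  γ-onto : ∀ {c} → c ∈Im γ → c ∈ A
  γ-onto (j , refl) with injective⇒surjective pre-inj j
  ... | x , refl = subst (_∈ A) (sym (γ∘pre x)) (e∈A x)

module Transversals {n m : ℕ} (L : ListAssignment (K n m))
                    (large : ∀ v → AtLeast n (L v)) (uncolourable : ColZero (K n m) L) where

  A : Fin n → FinSet
  A i = L (inj₁ i)

  B : Fin m → FinSet
  B k = L (inj₂ k)

  Transversal : (Fin n → ℕ) → Set
  Transversal γ = ∀ i → γ i ∈ A i

  blocked : ∀ {γ} → Transversal γ → ∃[ k ] B k ⊆Im γ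
  blocked {γ} γ∈A with any? (λ k → all? (_∈Im? γ) (B k))
  ... | yes (k , B⊆γ) = k , lookup B⊆γ
  ... | no unblocked = ⊥-elim (uncolourable (colour , colour∈L , proper))
    where
    avoid : ∀ k → ∃[ c ] (c ∈ B k × ¬ c ∈Im γ)
    avoid k = find (¬All⇒Any¬ (_∈Im? γ) (B k) (unblocked ∘ (k ,_)))
    colour : V (K n m) → ℕ
    colour (inj₁ i) = γ i
    colour (inj₂ k) = proj₁ (avoid k)
    colour∈L : ∀ v → colour v ∈ L v
    colour∈L (inj₁ i) = γ∈A i
    colour∈L (inj₂ k) = proj₁ (proj₂ (avoid k))
    proper : ∀ v w → Adj (K n m) v w → colour v ≢ colour w
    proper (inj₁ i) (inj₂ k) _ eq = proj₂ (proj₂ (avoid k)) (i , eq)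
    proper (inj₂ k) (inj₁ i) _ eq = proj₂ (proj₂ (avoid k)) (i , sym eq)

  blocked-enumerates : ∀ {γ} → Transversal γ → ∃[ k ] γ Enumerates B k
  blocked-enumerates γ∈A with k , B⊆γ ← blocked γ∈A =
    k , ⊆Im∧AtLeast⇒Enumerates (large (inj₂ k)) B⊆γ

  enum : ∀ i → Fin n → ℕ
  enum i = proj₁ (large (inj₁ i))

  enum-injective : ∀ i → Injective _≡_ _≡_ (enum i)
  enum-injective i = proj₁ (proj₂ (large (inj₁ i)))

  enum∈A : ∀ i x → enum i x ∈ A i
  enum∈A i = proj₂ (proj₂ (large (inj₁ i)))

  select : (Fin n → Fin n) → Fin n → ℕ
  select t i = enum i (t i)

  select-transversal : ∀ t → Transversal (select t)
  select-transversal t i = enum∈A i (t i)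

  _[_≔_] : (Fin n → ℕ) → Fin n → ℕ → Fin n → ℕ
  γ [ i ≔ c ] = updateAt γ i (λ _ → c)

  ≔-transversal : ∀ {γ i c} → Transversal γ → c ∈ A i → Transversal (γ [ i ≔ c ])
  ≔-transversal {γ} {i} {c} γ∈A c∈Aᵢ j with j ≟ᶠ i
  ... | yes refl = subst (_∈ A i) (sym (updateAt-updates i γ)) c∈Aᵢ
  ... | no j≢i   = subst (_∈ A j) (sym (updateAt-minimal j i γ j≢i)) (γ∈A j)

  disjoint : ∀ i j → i ≢ j → ∀ c → c ∈ A i → ¬ c ∈ A j
  disjoint i j i≢j c c∈Aᵢ c∈Aⱼ = i≢j (γ-injective (trans γᵢ≡c (sym γⱼ≡c)))
    where
    γ : Fin n → ℕ
    γ = (select id [ j ≔ c ]) [ i ≔ c ]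
    γ-injective : Injective _≡_ _≡_ γ
    γ-injective = proj₁ (proj₂ (blocked-enumerates
      (≔-transversal (≔-transversal (select-transversal id) c∈Aⱼ) c∈Aᵢ)))
    γᵢ≡c : γ i ≡ c
    γᵢ≡c = updateAt-updates i _
    γⱼ≡c : γ j ≡ c
    γⱼ≡c = trans (updateAt-minimal j i _ (i≢j ∘ sym)) (updateAt-updates j _)

  owner-unique : ∀ {c i j} → c ∈ A i → c ∈ A j → i ≡ j
  owner-unique {c} {i} {j} c∈Aᵢ c∈Aⱼ with i ≟ᶠ j
  ... | yes i≡j = i≡j
  ... | no i≢j  = ⊥-elim (disjoint i j i≢j c c∈Aᵢ c∈Aⱼ)

  ∈Im-select : ∀ {c i} t → c ∈ A i → c ∈Im select t → c ≡ select t i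
  ∈Im-select t c∈Aᵢ (j , refl) with refl ← owner-unique c∈Aᵢ (select-transversal t j) = refl

  select-determined : ∀ {t t′ X} → (∀ i → select t i ∈ X) → X ⊆Im select t′ → t ≗ t′
  select-determined {t} {t′} t⊆X X⊆t′ i =
    enum-injective i (∈Im-select t′ (select-transversal t i) (X⊆t′ (t⊆X i)))

module Counting {n : ℕ} (L : ListAssignment (K n (n ^ n)))
                (large : ∀ v → AtLeast n (L v)) (uncolourable : ColZero (K n (n ^ n)) L) where

  open Transversals L large uncolourable

  blocker : Fin (n ^ n) → Fin (n ^ n)
  blocker x = proj₁ (blocked-enumerates (select-transversal (finToFun x)))

  blocker-enumerates : ∀ x → select (finToFun x) Enumerates B (blocker x)
  blocker-enumerates x = proj₂ (blocked-enumerates (select-transversal (finToFun x)))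

  blocker-injective : Injective _≡_ _≡_ blocker
  blocker-injective {x} {y} eq = finToFun-injective (select-determined
    (subst (λ k → ∀ i → select (finToFun x) i ∈ B k) eq (Enumerates⇒∈ (blocker-enumerates x)))
    (Enumerates⇒⊆Im (blocker-enumerates y)))

  preimage : Fin (n ^ n) → Fin (n ^ n)
  preimage k = proj₁ (injective⇒surjective blocker-injective k)

  blocker∘preimage : ∀ k → blocker (preimage k) ≡ k
  blocker∘preimage k = proj₂ (injective⇒surjective blocker-injective k)

  tuple : Fin (n ^ n) → Fin n → Fin n
  tuple k = finToFun (preimage k)

  tuple-injective : ∀ {k l} → tuple k ≗ tuple l → k ≡ l
  tuple-injective {k} {l} eq = begin
    k                    ≡⟨ sym (blocker∘preimage k) ⟩
    blocker (preimage k) ≡⟨ cong blocker (finToFun-injective eq) ⟩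
    blocker (preimage l) ≡⟨ blocker∘preimage l ⟩
    l                    ∎
    where open ≡-Reasoning

  tuple-enumerates : ∀ k → select (tuple k) Enumerates B k
  tuple-enumerates k =
    subst (select (tuple k) Enumerates_ ∘ B) (blocker∘preimage k) (blocker-enumerates (preimage k))

  A∩B : ∀ {c i} k → c ∈ A i → c ∈ B k → c ≡ select (tuple k) i
  A∩B k c∈Aᵢ c∈Bₖ = ∈Im-select (tuple k) c∈Aᵢ (Enumerates⇒⊆Im (tuple-enumerates k) c∈Bₖ)

  A⊆enum : ∀ i → A i ⊆Im enum i
  A⊆enum i {c} c∈Aᵢ = tuple k i , sym (A∩B k c∈Aᵢ c∈Bₖ)
    where
    γ-transversal : Transversal (select id [ i ≔ c ])
    γ-transversal = ≔-transversal (select-transversal id) c∈Aᵢ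
    k : Fin (n ^ n)
    k = proj₁ (blocked-enumerates γ-transversal)
    c∈Bₖ : c ∈ B k
    c∈Bₖ = subst (_∈ B k) (updateAt-updates i _)
      (Enumerates⇒∈ (proj₂ (blocked-enumerates γ-transversal)) i)

  size : ∀ v → Size n (L v)
  size (inj₁ i) = enum i , enum-injective i , λ c →
    mk⇔ (A⊆enum i) (λ { (x , refl) → enum∈A i x })
  size (inj₂ k) = select (tuple k) , tuple-enumerates k

  B-distinct : ∀ k l → k ≢ l → ¬ B k ≐ B l
  B-distinct k l k≢l Bₖ≐Bₗ = k≢l (tuple-injective (select-determined
    (λ i → Equivalence.to (Bₖ≐Bₗ _) (Enumerates⇒∈ (tuple-enumerates k) i))
    (Enumerates⇒⊆Im (tuple-enumerates l))))

  A∩B-singleton : ∀ i k → ∃[ c ] ((c ∈ A i × c ∈ B k) × (∀ d → d ∈ A i → d ∈ B k → d ≡ c))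
  A∩B-singleton i k =
    select (tuple k) i , (select-transversal (tuple k) i , Enumerates⇒∈ (tuple-enumerates k) i) ,
    λ _ → A∩B k

  isL₀ : IsL₀ n L
  isL₀ = size , disjoint , B-distinct , A∩B-singleton

mainTheorem9 : (n : ℕ) → n ≥ 1 → (L : ListAssignment (K n (n ^ n))) →
    (∀ v → AtLeast n (L v)) →
    ColZero (K n (n ^ n)) L →
    Σ (ListAssignment (K n (n ^ n))) λ L₀ → IsL₀ n L₀ × Equivalent (K n (n ^ n)) L L₀
mainTheorem9 n _ L large uncolourable =
  L , Counting.isL₀ L large uncolourable , equivalent-refl (K n (n ^ n)) L
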